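{- Let $C\ge4$ be an integer. Let $a_i=\frac{C!}{(C-i)!}$ for $i=0,\dots,C$. For $z_1,\dots,z_C\in[0,\infty)$ and $z_{C+1}=1$, let $x=\sum_{k=1}^C a_kz_{k+1}$, $y=\sum_{k=2}^C a_kz_k$, and $$\tilde R(z_1,\dots,z_C)=\frac{(z_1+x)\left[\sum_{i=1}^4 a_i(a_1z_1+y)^{4-i}x^{i-1}\right]}{\sum_{i=0}^4 a_i(a_1z_1+y)^{4-i}x^{i}}.$$ If $y\le a_1z_1$, then $\tilde R(z_1,\dots,z_C)\ge\frac67$. -}

module Defs where

open import Level using (Level; _⊔_) renaming (suc to lsuc)
open import Data.Nat as ℕ using (ℕ; zero; suc; _∸_; _<?_)
open import Data.Nat.Properties using (_!≢0)
open import Data.Fin using (Fin; fromℕ<)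
open import Data.Product using (_×_)
open import Data.Sum using (_⊎_)
open import Relation.Nullary using (¬_; yes; no)
open import Relation.Binary.PropositionalEquality using (_≡_)
open import Algebra.Structures using (IsCommutativeRing)

-- The paper works over ℝ, which the standard library
-- lacks; we state the result for an arbitrary ordered field (ℝ is one).
-- The field has a total inverse _⁻¹ with x ≠ 0 → x * x⁻¹ = 1
-- (the value of 0⁻¹ is irrelevant here: all inverted quantities are
-- positive).

record OrderedField (c ℓ : Level) : Set (lsuc (c ⊔ ℓ)) where
  infixl 7 _*_
  infixl 6 _+_
  infix  4 _≤_
  infix  8 -_
  infix  9 _⁻¹
  field
    Carrier : Set c
    _+_ _*_ : Carrier → Carrier → Carrier
    -_ _⁻¹  : Carrier → Carrier
    0# 1#   : Carrier
    _≤_     : Carrier → Carrier → Set ℓ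
    isCommutativeRing : IsCommutativeRing _≡_ _+_ _*_ -_ 0# 1#
    0≢1        : ¬ (0# ≡ 1#)
    *-inverseʳ : ∀ x → ¬ (x ≡ 0#) → x * x ⁻¹ ≡ 1#
    ≤-refl     : ∀ {x} → x ≤ x
    ≤-trans    : ∀ {x y z} → x ≤ y → y ≤ z → x ≤ z
    ≤-antisym  : ∀ {x y} → x ≤ y → y ≤ x → x ≡ y
    ≤-total    : ∀ x y → x ≤ y ⊎ y ≤ x
    +-monoˡ-≤  : ∀ {x y} z → x ≤ y → x + z ≤ y + z
    0≤*        : ∀ {x y} → 0# ≤ x → 0# ≤ y → 0# ≤ x * y

module _ {c ℓ} (F : OrderedField c ℓ) where
  open OrderedField F

  fromℕ : ℕ → Carrier
  fromℕ zero    = 0#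
  fromℕ (suc n) = fromℕ n + 1#

  _^_ : Carrier → ℕ → Carrier
  x ^ zero  = 1#
  x ^ suc n = x * (x ^ n)

  Σ[_to_] : ℕ → ℕ → (ℕ → Carrier) → Carrier
  Σ[ m to n ] f = go (suc n ∸ m) m
    where
    go : ℕ → ℕ → Carrier
    go zero    k = 0#
    go (suc r) k = f k + go r (suc k)

  aℕ : ℕ → ℕ → ℕ
  aℕ C i = (C ℕ.! ℕ./ (C ∸ i) ℕ.!) {{(C ∸ i) !≢0}}

  a : ℕ → ℕ → Carrier
  a C i = fromℕ (aℕ C i)

  -- 1-based extension: Z k = z_k for 1 ≤ k ≤ C, and z_{C+1} = 1
  -- (only the indices 1, …, C+1 are ever used).
  Z : (C : ℕ) → (Fin C → Carrier) → ℕ → Carrier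
  Z C z zero    = 1#
  Z C z (suc k) with k <? C
  ... | yes k<C = z (fromℕ< k<C)
  ... | no  _   = 1#

  module Quantities (C : ℕ) (z : Fin C → Carrier) where
    x y w : Carrier
    x = Σ[ 1 to C ] (λ k → a C k * Z C z (suc k))
    y = Σ[ 2 to C ] (λ k → a C k * Z C z k)
    w = a C 1 * Z C z 1 + y

    numerator denominator R̃ : Carrier
    numerator   = (Z C z 1 + x) * Σ[ 1 to 4 ] (λ i → a C i * (w ^ (4 ∸ i)) * (x ^ (i ∸ 1)))
    denominator = Σ[ 0 to 4 ] (λ i → a C i * (w ^ (4 ∸ i)) * (x ^ i))
    R̃ = numerator * denominator ⁻¹

module Submission where

-- Write t = z₁, w = a₁t + y and S = Σ_{i=1}^{4} a_i w^{4-i} x^{i-1}.  The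
-- numerator of R̃ is (t + x)S and, since a₀ = 1, the denominator is w⁴ + xS,
-- so R̃ ≥ 6/7 amounts to 6w⁴ ≤ (7t + x)S.  Keeping only the first two terms
-- of S and using a₂ = a₁(C-1) and a₁ ≥ C-1, the right-hand side is at least
-- w²(7u + v)(w + v) with u = a₁t and v = (C-1)x.  By hypothesis y ≤ u, and
-- y ≤ v because a_{k+1} ≤ (C-1)a_k termwise; the elementary inequality
-- 6(u + y)² ≤ (7u + v)(u + y + v) for 0 ≤ y ≤ u, v then concludes.

open import Defs using (OrderedField; module Quantities; fromℕ; aℕ; a; Z)
open import Level using (_⊔_)
open import Data.Nat using (ℕ) renaming (_≤_ to _≤ℕ_)
open import Data.Fin using (Fin)

import Data.Nat as ℕ
import Data.Nat.Properties as ℕ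
open import Data.Nat.Combinatorics.Base using (_P′_)
open import Data.Nat.Combinatorics.Specification using (nP′k≡n!/[n∸k]!)
open import Data.Product using (Σ-syntax; _×_; _,_)
open import Data.Sum using (inj₁; inj₂)
open import Relation.Nullary using (¬_; yes; no; contradiction)
open import Relation.Binary.PropositionalEquality
  using (_≡_; refl; sym; trans; cong; cong₂; subst; subst₂; isEquivalence; module ≡-Reasoning)
open import Relation.Binary.Bundles using (Poset)
import Relation.Binary.Reasoning.PartialOrder
open import Algebra.Bundles using (CommutativeSemiring; CommutativeRing)
open import Algebra.Structures using (IsCommutativeRing)

module OrderedFieldTheory {c ℓ} (F : OrderedField c ℓ) where
  open OrderedField F
  open IsCommutativeRing isCommutativeRing
    using (+-comm; +-assoc; *-comm; *-assoc; +-identityˡ; +-identityʳ; *-identityˡ; *-identityʳ;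
           -‿inverseˡ; -‿inverseʳ; distribˡ; distribʳ; zeroˡ; zeroʳ)
  private
    ring = CommutativeRing.ring (record { isCommutativeRing = isCommutativeRing })
    semiring : CommutativeSemiring c c
    semiring = record { isCommutativeSemiring = IsCommutativeRing.isCommutativeSemiring isCommutativeRing }
  open import Algebra.Properties.Ring ring using (-‿involutive; -‿distribˡ-*; -‿distribʳ-*)
  open import Algebra.Solver.Ring.NaturalCoefficients.Default semiring
    using (Polynomial; solve; _:=_; _:+_; _:*_; con)

  infixr 8 _^_
  _^_ : Carrier → ℕ → Carrier
  _^_ = Defs._^_ F

  Σ[_to_] : ℕ → ℕ → (ℕ → Carrier) → Carrier
  Σ[_to_] = Defs.Σ[_to_] F

  numeral : ∀ {k} → ℕ → Polynomial k
  numeral ℕ.zero    = con 0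
  numeral (ℕ.suc n) = numeral n :+ con 1

  +-monoʳ-≤ : ∀ {a b} z → a ≤ b → z + a ≤ z + b
  +-monoʳ-≤ {a} {b} z a≤b = subst₂ _≤_ (+-comm a z) (+-comm b z) (+-monoˡ-≤ z a≤b)

  +-mono-≤ : ∀ {a b d e} → a ≤ b → d ≤ e → a + d ≤ b + e
  +-mono-≤ {b = b} a≤b d≤e = ≤-trans (+-monoˡ-≤ _ a≤b) (+-monoʳ-≤ b d≤e)

  ≤-+ʳ : ∀ {b} a → 0# ≤ b → a ≤ a + b
  ≤-+ʳ {b} a 0≤b = subst (_≤ a + b) (+-identityʳ a) (+-monoʳ-≤ a 0≤b)

  +-nonneg : ∀ {a b} → 0# ≤ a → 0# ≤ b → 0# ≤ a + b
  +-nonneg {a} 0≤a 0≤b = ≤-trans 0≤a (≤-+ʳ a 0≤b)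

  ≤-poset : Poset c c ℓ
  ≤-poset = record
    { isPartialOrder = record
      { isPreorder = record
        { isEquivalence = isEquivalence ; reflexive = λ { refl → ≤-refl } ; trans = ≤-trans }
      ; antisym = ≤-antisym } }

  module ≤-Reasoning = Relation.Binary.Reasoning.PartialOrder ≤-poset

  ≤⇒0≤difference : ∀ {a b} → a ≤ b → 0# ≤ b + - a
  ≤⇒0≤difference {a} {b} a≤b = subst (_≤ b + - a) (-‿inverseʳ a) (+-monoˡ-≤ (- a) a≤b)

  ≤-split : ∀ {a b} → a ≤ b → Σ[ r ∈ Carrier ] 0# ≤ r × b ≡ a + r
  ≤-split {a} {b} a≤b = b + - a , ≤⇒0≤difference a≤b , b≡a+[b-a]
    where
    open ≡-Reasoning
    b≡a+[b-a] : b ≡ a + (b + - a)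
    b≡a+[b-a] = begin
      b              ≡⟨ sym (+-identityʳ b) ⟩
      b + 0#         ≡⟨ cong (b +_) (sym (-‿inverseˡ a)) ⟩
      b + (- a + a)  ≡⟨ sym (+-assoc b (- a) a) ⟩
      b + - a + a    ≡⟨ +-comm (b + - a) a ⟩
      a + (b + - a)  ∎

  -- Multiplication by a nonnegative element is monotone: if b = a + r then
  -- be = ae + re with re ≥ 0.
  *-monoʳ-≤ : ∀ {a b e} → 0# ≤ e → a ≤ b → a * e ≤ b * e
  *-monoʳ-≤ {a} {b} {e} 0≤e a≤b with ≤-split a≤b
  ... | r , 0≤r , refl = subst (a * e ≤_) (sym (distribʳ e a r)) (≤-+ʳ (a * e) (0≤* 0≤r 0≤e))

  *-monoˡ-≤ : ∀ {a b e} → 0# ≤ e → a ≤ b → e * a ≤ e * b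
  *-monoˡ-≤ {a} {b} {e} 0≤e a≤b = subst₂ _≤_ (*-comm a e) (*-comm b e) (*-monoʳ-≤ 0≤e a≤b)

  -- Squares are nonnegative (a ≤ 0 gives -a ≥ 0 and a² = (-a)²); so 0 ≤ 1.
  square-nonneg : ∀ a → 0# ≤ a * a
  square-nonneg a with ≤-total 0# a
  ... | inj₁ 0≤a = 0≤* 0≤a 0≤a
  ... | inj₂ a≤0 = subst (0# ≤_) neg-square (0≤* 0≤-a 0≤-a)
    where
    open ≡-Reasoning
    0≤-a : 0# ≤ - a
    0≤-a = subst (0# ≤_) (+-identityˡ (- a)) (≤⇒0≤difference a≤0)
    neg-square : - a * - a ≡ a * a
    neg-square = begin
      - a * - a      ≡⟨ sym (-‿distribˡ-* a (- a)) ⟩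
      - (a * - a)    ≡⟨ cong -_ (sym (-‿distribʳ-* a a)) ⟩
      - (- (a * a))  ≡⟨ -‿involutive (a * a) ⟩
      a * a          ∎

  0≤1 : 0# ≤ 1#
  0≤1 = subst (0# ≤_) (*-identityˡ 1#) (square-nonneg 1#)

  1≤-* : ∀ {a b} → 1# ≤ a → 1# ≤ b → 1# ≤ a * b
  1≤-* {a} {b} 1≤a 1≤b = ≤-trans (subst (_≤ a * 1#) (*-identityʳ 1#) (*-monoʳ-≤ 0≤1 1≤a))
                                  (*-monoˡ-≤ (≤-trans 0≤1 1≤a) 1≤b)

  ^-nonneg : ∀ {a} → 0# ≤ a → ∀ n → 0# ≤ a ^ n
  ^-nonneg 0≤a ℕ.zero    = 0≤1
  ^-nonneg 0≤a (ℕ.suc n) = 0≤* 0≤a (^-nonneg 0≤a n)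

  1≤-^ : ∀ {a} → 1# ≤ a → ∀ n → 1# ≤ a ^ n
  1≤-^ 1≤a ℕ.zero    = ≤-refl
  1≤-^ 1≤a (ℕ.suc n) = 1≤-* 1≤a (1≤-^ 1≤a n)

  -- Positive elements have nonnegative inverses (a⁻¹ = a · (a⁻¹)²), which
  -- lets us clear denominators in an inequality between quotients.
  Positive : Carrier → Set (c ⊔ ℓ)
  Positive a = 0# ≤ a × ¬ (a ≡ 0#)

  1≤⇒positive : ∀ {a} → 1# ≤ a → Positive a
  1≤⇒positive 1≤a = ≤-trans 0≤1 1≤a , λ { refl → 0≢1 (≤-antisym 0≤1 1≤a) }

  ⁻¹-nonneg : ∀ {a} → Positive a → 0# ≤ a ⁻¹
  ⁻¹-nonneg {a} (0≤a , a≢0) = subst (0# ≤_) a[a⁻¹a⁻¹]≡a⁻¹ (0≤* 0≤a (square-nonneg (a ⁻¹)))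
    where
    open ≡-Reasoning
    a[a⁻¹a⁻¹]≡a⁻¹ : a * (a ⁻¹ * a ⁻¹) ≡ a ⁻¹
    a[a⁻¹a⁻¹]≡a⁻¹ = begin
      a * (a ⁻¹ * a ⁻¹)  ≡⟨ sym (*-assoc a (a ⁻¹) (a ⁻¹)) ⟩
      a * a ⁻¹ * a ⁻¹    ≡⟨ cong (_* a ⁻¹) (*-inverseʳ a a≢0) ⟩
      1# * a ⁻¹          ≡⟨ *-identityˡ (a ⁻¹) ⟩
      a ⁻¹               ∎

  cross-multiply : ∀ {p q r s} → Positive q → Positive s → p * s ≤ r * q → p * q ⁻¹ ≤ r * s ⁻¹
  cross-multiply {p} {q} {r} {s} q>0@(_ , q≢0) s>0@(_ , s≢0) ps≤rq =
    subst₂ _≤_ (cancel p s q s≢0) (trans (cong (r * q *_) (*-comm (q ⁻¹) (s ⁻¹))) (cancel r q s q≢0))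
      (*-monoʳ-≤ (0≤* (⁻¹-nonneg q>0) (⁻¹-nonneg s>0)) ps≤rq)
    where
    open ≡-Reasoning
    regroup : ∀ u v w x → u * v * (w * x) ≡ u * w * (v * x)
    regroup = solve 4 (λ u v w x → u :* v :* (w :* x) := u :* w :* (v :* x)) refl
    cancel : ∀ u v w → ¬ (v ≡ 0#) → u * v * (w ⁻¹ * v ⁻¹) ≡ u * w ⁻¹
    cancel u v w v≢0 = begin
      u * v * (w ⁻¹ * v ⁻¹)    ≡⟨ regroup u v (w ⁻¹) (v ⁻¹) ⟩
      u * w ⁻¹ * (v * v ⁻¹)    ≡⟨ cong (u * w ⁻¹ *_) (*-inverseʳ v v≢0) ⟩
      u * w ⁻¹ * 1#            ≡⟨ *-identityʳ (u * w ⁻¹) ⟩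
      u * w ⁻¹                 ∎

  fromℕ-+ : ∀ m n → fromℕ F (m ℕ.+ n) ≡ fromℕ F m + fromℕ F n
  fromℕ-+ ℕ.zero    n = sym (+-identityˡ (fromℕ F n))
  fromℕ-+ (ℕ.suc m) n = begin
    fromℕ F (m ℕ.+ n) + 1#            ≡⟨ cong (_+ 1#) (fromℕ-+ m n) ⟩
    fromℕ F m + fromℕ F n + 1#        ≡⟨ swap (fromℕ F m) (fromℕ F n) ⟩
    fromℕ F m + 1# + fromℕ F n        ∎
    where
    open ≡-Reasoning
    swap : ∀ u v → u + v + 1# ≡ u + 1# + v
    swap = solve 2 (λ u v → u :+ v :+ con 1 := u :+ con 1 :+ v) refl

  fromℕ-* : ∀ m n → fromℕ F (m ℕ.* n) ≡ fromℕ F m * fromℕ F n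
  fromℕ-* ℕ.zero    n = sym (zeroˡ (fromℕ F n))
  fromℕ-* (ℕ.suc m) n = begin
    fromℕ F (n ℕ.+ m ℕ.* n)               ≡⟨ fromℕ-+ n (m ℕ.* n) ⟩
    fromℕ F n + fromℕ F (m ℕ.* n)         ≡⟨ cong (fromℕ F n +_) (fromℕ-* m n) ⟩
    fromℕ F n + fromℕ F m * fromℕ F n     ≡⟨ factor (fromℕ F m) (fromℕ F n) ⟩
    (fromℕ F m + 1#) * fromℕ F n          ∎
    where
    open ≡-Reasoning
    factor : ∀ u v → v + u * v ≡ (u + 1#) * v
    factor = solve 2 (λ u v → v :+ u :* v := (u :+ con 1) :* v) refl

  fromℕ-nonneg : ∀ n → 0# ≤ fromℕ F n
  fromℕ-nonneg ℕ.zero    = ≤-refl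
  fromℕ-nonneg (ℕ.suc n) = +-nonneg (fromℕ-nonneg n) 0≤1

  fromℕ-mono : ∀ {m n} → m ≤ℕ n → fromℕ F m ≤ fromℕ F n
  fromℕ-mono {m} {n} m≤n =
    subst (fromℕ F m ≤_) (trans (sym (fromℕ-+ m (n ℕ.∸ m))) (cong (fromℕ F) (ℕ.m+[n∸m]≡n m≤n)))
      (≤-+ʳ (fromℕ F m) (fromℕ-nonneg (n ℕ.∸ m)))

  1≤fromℕ : ∀ {n} → 1 ≤ℕ n → 1# ≤ fromℕ F n
  1≤fromℕ {n} 1≤n = subst (_≤ fromℕ F n) (+-identityˡ 1#) (fromℕ-mono 1≤n)

  sumFrom : ℕ → ℕ → (ℕ → Carrier) → Carrier
  sumFrom k ℕ.zero    f = 0#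
  sumFrom k (ℕ.suc r) f = f k + sumFrom (ℕ.suc k) r f

  Σ-step : ∀ f n k → k ≤ℕ n → Σ[ k to n ] f ≡ f k + Σ[ ℕ.suc k to n ] f
  Σ-step f n k k≤n rewrite ℕ.+-∸-assoc 1 k≤n = refl

  Σ≡sumFrom : ∀ f n r k → r ℕ.+ k ≡ ℕ.suc n → Σ[ k to n ] f ≡ sumFrom k r f
  Σ≡sumFrom f n ℕ.zero    .(ℕ.suc n) refl rewrite ℕ.n∸n≡0 n = refl
  Σ≡sumFrom f n (ℕ.suc r) k r+k≡n = begin
    Σ[ k to n ] f                ≡⟨ Σ-step f n k k≤n ⟩
    f k + Σ[ ℕ.suc k to n ] f    ≡⟨ cong (f k +_) (Σ≡sumFrom f n r (ℕ.suc k) r+[k+1]≡n) ⟩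
    f k + sumFrom (ℕ.suc k) r f  ∎
    where
    open ≡-Reasoning
    r+[k+1]≡n : r ℕ.+ ℕ.suc k ≡ ℕ.suc n
    r+[k+1]≡n = trans (ℕ.+-suc r k) r+k≡n
    k≤n : k ≤ℕ n
    k≤n = ℕ.≤-pred (subst (ℕ.suc k ≤ℕ_) r+[k+1]≡n (ℕ.m≤n+m (ℕ.suc k) r))

  sumFrom-nonneg : ∀ {f} → (∀ j → 0# ≤ f j) → ∀ k r → 0# ≤ sumFrom k r f
  sumFrom-nonneg f≥0 k ℕ.zero    = ≤-refl
  sumFrom-nonneg f≥0 k (ℕ.suc r) = +-nonneg (f≥0 k) (sumFrom-nonneg f≥0 (ℕ.suc k) r)

  sumFrom-snoc : ∀ f k r → sumFrom k (ℕ.suc r) f ≡ sumFrom k r f + f (k ℕ.+ r)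
  sumFrom-snoc f k ℕ.zero = begin
    f k + 0#          ≡⟨ +-identityʳ (f k) ⟩
    f k               ≡⟨ cong f (sym (ℕ.+-identityʳ k)) ⟩
    f (k ℕ.+ 0)       ≡⟨ sym (+-identityˡ (f (k ℕ.+ 0))) ⟩
    0# + f (k ℕ.+ 0)  ∎
    where open ≡-Reasoning
  sumFrom-snoc f k (ℕ.suc r) = begin
    f k + sumFrom (ℕ.suc k) (ℕ.suc r) f                     ≡⟨ cong (f k +_) (sumFrom-snoc f (ℕ.suc k) r) ⟩
    f k + (sumFrom (ℕ.suc k) r f + f (ℕ.suc k ℕ.+ r))       ≡⟨ sym (+-assoc (f k) _ _) ⟩
    f k + sumFrom (ℕ.suc k) r f + f (ℕ.suc k ℕ.+ r)         ≡⟨ cong (λ i → f k + sumFrom (ℕ.suc k) r f + f i) (sym (ℕ.+-suc k r)) ⟩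
    f k + sumFrom (ℕ.suc k) r f + f (k ℕ.+ ℕ.suc r)         ∎
    where open ≡-Reasoning

  sumFrom-init : ∀ {f} → (∀ j → 0# ≤ f j) → ∀ k r → sumFrom k r f ≤ sumFrom k (ℕ.suc r) f
  sumFrom-init {f} f≥0 k r = subst (sumFrom k r f ≤_) (sym (sumFrom-snoc f k r)) (≤-+ʳ _ (f≥0 (k ℕ.+ r)))

  sumFrom-last : ∀ {f} → (∀ j → 0# ≤ f j) → ∀ k r → f (k ℕ.+ r) ≤ sumFrom k (ℕ.suc r) f
  sumFrom-last {f} f≥0 k r =
    subst₂ _≤_ (+-identityˡ (f (k ℕ.+ r))) (sym (sumFrom-snoc f k r))
      (+-monoˡ-≤ (f (k ℕ.+ r)) (sumFrom-nonneg f≥0 k r))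

  sumFrom-shift : ∀ f k r → sumFrom (ℕ.suc k) r f ≡ sumFrom k r (λ j → f (ℕ.suc j))
  sumFrom-shift f k ℕ.zero    = refl
  sumFrom-shift f k (ℕ.suc r) = cong (f (ℕ.suc k) +_) (sumFrom-shift f (ℕ.suc k) r)

  sumFrom-mono : ∀ {f g} k r → (∀ j → k ≤ℕ j → j ℕ.< k ℕ.+ r → f j ≤ g j) → sumFrom k r f ≤ sumFrom k r g
  sumFrom-mono k ℕ.zero    f≤g = ≤-refl
  sumFrom-mono k (ℕ.suc r) f≤g =
    +-mono-≤ (f≤g k ℕ.≤-refl (ℕ.m<m+n k ℕ.z<s))
             (sumFrom-mono (ℕ.suc k) r λ j k<j j<k+1+r →
                f≤g j (ℕ.<⇒≤ k<j) (subst (j ℕ.<_) (sym (ℕ.+-suc k r)) j<k+1+r))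

  sumFrom-scale : ∀ e f k r → e * sumFrom k r f ≡ sumFrom k r (λ j → e * f j)
  sumFrom-scale e f k ℕ.zero    = zeroʳ e
  sumFrom-scale e f k (ℕ.suc r) = trans (distribˡ e (f k) _) (cong (e * f k +_) (sumFrom-scale e f (ℕ.suc k) r))

  sumFrom-cong : ∀ {f g} k r → (∀ j → f j ≡ g j) → sumFrom k r f ≡ sumFrom k r g
  sumFrom-cong k ℕ.zero    f≡g = refl
  sumFrom-cong k (ℕ.suc r) f≡g = cong₂ _+_ (f≡g k) (sumFrom-cong (ℕ.suc k) r f≡g)

  -- Writing u = y + r and v = y + s, the
  -- difference is 5yr + 11ys + r² + 8rs + s², a sum of nonnegative terms.
  quadratic-bound : ∀ {u v y} → 0# ≤ y → y ≤ u → y ≤ v →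
                    fromℕ F 6 * ((u + y) * (u + y)) ≤ (fromℕ F 7 * u + v) * (u + y + v)
  quadratic-bound {u} {v} {y} 0≤y y≤u y≤v with ≤-split y≤u | ≤-split y≤v
  ... | r , 0≤r , refl | s , 0≤s , refl =
    subst (fromℕ F 6 * (w * w) ≤_) (sym expand) (≤-+ʳ (fromℕ F 6 * (w * w)) excess-nonneg)
    where
    w excess : Carrier
    w = y + r + y
    excess = y * (fromℕ F 5 * r + fromℕ F 11 * s) + (r * (r + fromℕ F 8 * s) + s * s)
    excess-nonneg : 0# ≤ excess
    excess-nonneg =
      +-nonneg (0≤* 0≤y (+-nonneg (0≤* (fromℕ-nonneg 5) 0≤r) (0≤* (fromℕ-nonneg 11) 0≤s)))
               (+-nonneg (0≤* 0≤r (+-nonneg 0≤r (0≤* (fromℕ-nonneg 8) 0≤s))) (square-nonneg s))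
    expand : (fromℕ F 7 * (y + r) + (y + s)) * (w + (y + s)) ≡ fromℕ F 6 * (w * w) + excess
    expand = solve 3 (λ y r s →
      (numeral 7 :* (y :+ r) :+ (y :+ s)) :* (y :+ r :+ y :+ (y :+ s))
        := numeral 6 :* ((y :+ r :+ y) :* (y :+ r :+ y))
           :+ (y :* (numeral 5 :* r :+ numeral 11 :* s) :+ (r :* (r :+ numeral 8 :* s) :+ s :* s))) refl y r s

  -- The properties of the coefficient sequence a_i = C!/(C-i)! (with m = C - 1)
  -- that the ratio bound needs.
  record Coefficients (α : ℕ → Carrier) (m : Carrier) : Set (c ⊔ ℓ) where
    field
      α-nonneg : ∀ i → 0# ≤ α i
      α₀≡1     : α 0 ≡ 1#
      α₂≡α₁m   : α 2 ≡ α 1 * m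
      m-nonneg : 0# ≤ m
      m≤α₁     : m ≤ α 1
      1≤α₄     : 1# ≤ α 4

  module Ratio (α : ℕ → Carrier) (t x y : Carrier) where
    w : Carrier
    w = α 1 * t + y

    numTerm denTerm : ℕ → Carrier
    numTerm i = α i * w ^ (4 ℕ.∸ i) * x ^ (i ℕ.∸ 1)
    denTerm i = α i * w ^ (4 ℕ.∸ i) * x ^ i

    S numerator denominator : Carrier
    S           = Σ[ 1 to 4 ] numTerm
    numerator   = (t + x) * S
    denominator = Σ[ 0 to 4 ] denTerm

    -- Beyond its first term w⁴, the denominator is x · S (the sums have
    -- literal bounds, so they unfold to sumFrom definitionally).
    denominator-split : α 0 ≡ 1# → denominator ≡ w ^ 4 + x * S
    denominator-split α₀≡1 = begin
      denTerm 0 + sumFrom 0 4 (λ j → denTerm (ℕ.suc j))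
        ≡⟨ cong₂ _+_ first-term (sumFrom-cong 0 4 shifted-term) ⟩
      w ^ 4 + sumFrom 0 4 (λ j → x * numTerm (ℕ.suc j))
        ≡⟨ cong (w ^ 4 +_) (sym (sumFrom-scale x (λ j → numTerm (ℕ.suc j)) 0 4)) ⟩
      w ^ 4 + x * S
        ∎
      where
      open ≡-Reasoning
      first-term : denTerm 0 ≡ w ^ 4
      first-term = trans (cong (λ a₀ → a₀ * w ^ 4 * 1#) α₀≡1)
                         (trans (*-identityʳ _) (*-identityˡ _))
      shifted-term : ∀ j → denTerm (ℕ.suc j) ≡ x * numTerm (ℕ.suc j)
      shifted-term j = solve 4 (λ a p x q → a :* p :* (x :* q) := x :* (a :* p :* q)) refl
                         (α (ℕ.suc j)) (w ^ (3 ℕ.∸ j)) x (x ^ j)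

    module Bound {m : Carrier} (coeff : Coefficients α m) (0≤t : 0# ≤ t) (0≤y : 0# ≤ y)
                 (1≤x : 1# ≤ x) (y≤α₁t : y ≤ α 1 * t) (y≤mx : y ≤ m * x) where
      open Coefficients coeff

      0≤x : 0# ≤ x
      0≤x = ≤-trans 0≤1 1≤x

      0≤w : 0# ≤ w
      0≤w = +-nonneg (0≤* (α-nonneg 1) 0≤t) 0≤y

      numTerm-nonneg : ∀ i → 0# ≤ numTerm i
      numTerm-nonneg i = 0≤* (0≤* (α-nonneg i) (^-nonneg 0≤w (4 ℕ.∸ i))) (^-nonneg 0≤x (i ℕ.∸ 1))

      denTerm-nonneg : ∀ i → 0# ≤ denTerm i
      denTerm-nonneg i = 0≤* (0≤* (α-nonneg i) (^-nonneg 0≤w (4 ℕ.∸ i))) (^-nonneg 0≤x i)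

      S-lower : sumFrom 1 2 numTerm ≤ S
      S-lower = ≤-trans (sumFrom-init numTerm-nonneg 1 2) (sumFrom-init numTerm-nonneg 1 3)

      -- The heart of the proof: 6w⁴ ≤ (7t + x)·S.  With u = α₁t and v = m·x,
      -- S ≥ α₁w²(w + v) and α₁x ≥ v, so (7t + x)·S ≥ w²(7u + v)(w + v) ≥ 6w⁴
      -- by quadratic-bound, as y ≤ u and y ≤ v.
      numerator-bound : fromℕ F 6 * w ^ 4 ≤ (fromℕ F 7 * t + x) * S
      numerator-bound = begin
        fromℕ F 6 * w ^ 4
          ≡⟨ square-out w ⟩
        w * w * (fromℕ F 6 * (w * w))
          ≤⟨ *-monoˡ-≤ (square-nonneg w) (quadratic-bound 0≤y y≤α₁t y≤mx) ⟩
        w * w * ((fromℕ F 7 * (α 1 * t) + m * x) * (w + m * x))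
          ≤⟨ *-monoˡ-≤ (square-nonneg w) (*-monoʳ-≤ 0≤w+mx 7u+mx≤7u+α₁x) ⟩
        w * w * ((fromℕ F 7 * (α 1 * t) + α 1 * x) * (w + m * x))
          ≡⟨ two-terms ⟩
        (fromℕ F 7 * t + x) * sumFrom 1 2 numTerm
          ≤⟨ *-monoˡ-≤ 0≤7t+x S-lower ⟩
        (fromℕ F 7 * t + x) * S
          ∎
        where
        open ≤-Reasoning
        0≤w+mx : 0# ≤ w + m * x
        0≤w+mx = +-nonneg 0≤w (0≤* m-nonneg 0≤x)
        7u+mx≤7u+α₁x : fromℕ F 7 * (α 1 * t) + m * x ≤ fromℕ F 7 * (α 1 * t) + α 1 * x
        7u+mx≤7u+α₁x = +-monoʳ-≤ _ (*-monoʳ-≤ 0≤x m≤α₁)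
        0≤7t+x : 0# ≤ fromℕ F 7 * t + x
        0≤7t+x = +-nonneg (0≤* (fromℕ-nonneg 7) 0≤t) 0≤x
        square-out : ∀ w → fromℕ F 6 * w ^ 4 ≡ w * w * (fromℕ F 6 * (w * w))
        square-out = solve 1 (λ w →
          numeral 6 :* (w :* (w :* (w :* (w :* con 1)))) := w :* w :* (numeral 6 :* (w :* w))) refl
        factor : ∀ a₁ m t x w →
          w * w * ((fromℕ F 7 * (a₁ * t) + a₁ * x) * (w + m * x))
            ≡ (fromℕ F 7 * t + x) * (a₁ * w ^ 3 * x ^ 0 + (a₁ * m * w ^ 2 * x ^ 1 + 0#))
        factor = solve 5 (λ a₁ m t x w →
          w :* w :* ((numeral 7 :* (a₁ :* t) :+ a₁ :* x) :* (w :+ m :* x))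
            := (numeral 7 :* t :+ x) :* (a₁ :* (w :* (w :* (w :* con 1))) :* con 1
                                          :+ (a₁ :* m :* (w :* (w :* con 1)) :* (x :* con 1) :+ con 0))) refl
        two-terms : w * w * ((fromℕ F 7 * (α 1 * t) + α 1 * x) * (w + m * x))
                      ≡ (fromℕ F 7 * t + x) * sumFrom 1 2 numTerm
        two-terms = trans (factor (α 1) m t x w)
          (cong (λ α₂ → (fromℕ F 7 * t + x) * (numTerm 1 + (α₂ * w ^ 2 * x ^ 1 + 0#)))
                (sym α₂≡α₁m))

      six-den≤seven-num : fromℕ F 6 * denominator ≤ numerator * fromℕ F 7
      six-den≤seven-num = begin
        fromℕ F 6 * denominator                        ≡⟨ cong (fromℕ F 6 *_) (denominator-split α₀≡1) ⟩
        fromℕ F 6 * (w ^ 4 + x * S)                    ≡⟨ distribˡ (fromℕ F 6) _ _ ⟩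
        fromℕ F 6 * w ^ 4 + fromℕ F 6 * (x * S)        ≤⟨ +-monoˡ-≤ _ numerator-bound ⟩
        (fromℕ F 7 * t + x) * S + fromℕ F 6 * (x * S)  ≡⟨ collect t x S ⟩
        numerator * fromℕ F 7                          ∎
        where
        open ≤-Reasoning
        collect : ∀ t x S → (fromℕ F 7 * t + x) * S + fromℕ F 6 * (x * S) ≡ (t + x) * S * fromℕ F 7
        collect = solve 3 (λ t x S →
          (numeral 7 :* t :+ x) :* S :+ numeral 6 :* (x :* S) := (t :+ x) :* S :* numeral 7) refl

      -- The denominator is at least its last term α₄x⁴ ≥ 1, so it is positive.
      1≤denominator : 1# ≤ denominator
      1≤denominator = ≤-trans (1≤-* (1≤-* 1≤α₄ ≤-refl) (1≤-^ 1≤x 4)) (sumFrom-last denTerm-nonneg 0 4)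

      ratio-bound : fromℕ F 6 * (fromℕ F 7) ⁻¹ ≤ numerator * denominator ⁻¹
      ratio-bound = cross-multiply (1≤⇒positive (1≤fromℕ {7} (ℕ.s≤s ℕ.z≤n))) (1≤⇒positive 1≤denominator)
                                   six-den≤seven-num

P′-positive : ∀ {n k} → k ≤ℕ n → 1 ≤ℕ n P′ k
P′-positive {k = ℕ.zero}  _   = ℕ.≤-refl
P′-positive {k = ℕ.suc k} k<n = ℕ.*-mono-≤ (ℕ.m<n⇒0<n∸m k<n) (P′-positive (ℕ.<⇒≤ k<n))

P′-step : ∀ n {k} → 1 ≤ℕ k → n P′ ℕ.suc k ≤ℕ (n ℕ.∸ 1) ℕ.* (n P′ k)
P′-step n {k} 1≤k = ℕ.*-monoˡ-≤ (n P′ k) (ℕ.∸-monoʳ-≤ n 1≤k)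

module PaperQuantities {c ℓ} (F : OrderedField c ℓ) where
  open OrderedField F
  open IsCommutativeRing isCommutativeRing using (+-identityˡ; *-comm; *-assoc; *-identityʳ)
  open OrderedFieldTheory F

  a≡P′ : ∀ {C i} → i ≤ℕ C → a F C i ≡ fromℕ F (C P′ i)
  a≡P′ i≤C = cong (fromℕ F) (sym (nP′k≡n!/[n∸k]! i≤C))

  a-step : ∀ {C k} → 1 ≤ℕ k → ℕ.suc k ≤ℕ C → a F C (ℕ.suc k) ≤ fromℕ F (C ℕ.∸ 1) * a F C k
  a-step {C} {k} 1≤k k<C = subst₂ _≤_ (sym (a≡P′ k<C)) factor-out (fromℕ-mono (P′-step C 1≤k))
    where
    factor-out : fromℕ F ((C ℕ.∸ 1) ℕ.* (C P′ k)) ≡ fromℕ F (C ℕ.∸ 1) * a F C k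
    factor-out = trans (fromℕ-* (C ℕ.∸ 1) (C P′ k)) (cong (fromℕ F (C ℕ.∸ 1) *_) (sym (a≡P′ (ℕ.<⇒≤ k<C))))

  coefficients : ∀ {C} → 4 ≤ℕ C → Coefficients (a F C) (fromℕ F (C ℕ.∸ 1))
  coefficients {C} 4≤C = record
    { α-nonneg = λ i → fromℕ-nonneg (aℕ F C i)
    ; α₀≡1     = trans (a≡P′ {C} ℕ.z≤n) (+-identityˡ 1#)
    ; α₂≡α₁m   = trans (a≡P′ 2≤C) (trans (fromℕ-* (C ℕ.∸ 1) (C P′ 1))
                   (trans (*-comm _ _) (cong (_* fromℕ F (C ℕ.∸ 1)) (sym (a≡P′ 1≤C)))))
    ; m-nonneg = fromℕ-nonneg (C ℕ.∸ 1)
    ; m≤α₁     = subst (fromℕ F (C ℕ.∸ 1) ≤_) (sym (a≡P′ 1≤C))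
                   (fromℕ-mono (subst (C ℕ.∸ 1 ≤ℕ_) (sym (ℕ.*-identityʳ C)) (ℕ.m∸n≤m C 1)))
    ; 1≤α₄     = subst (1# ≤_) (sym (a≡P′ 4≤C)) (1≤fromℕ (P′-positive 4≤C))
    }
    where
    1≤C : 1 ≤ℕ C
    1≤C = ℕ.≤-trans (ℕ.s≤s ℕ.z≤n) 4≤C
    2≤C : 2 ≤ℕ C
    2≤C = ℕ.≤-trans (ℕ.s≤s (ℕ.s≤s ℕ.z≤n)) 4≤C

  module Sums (n : ℕ) (z : Fin (ℕ.suc n) → Carrier) (0≤z : ∀ j → 0# ≤ z j) where
    C : ℕ
    C = ℕ.suc n

    open Quantities F C z using (x; y)

    Z-nonneg : ∀ k → 0# ≤ Z F C z k
    Z-nonneg ℕ.zero    = 0≤1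
    Z-nonneg (ℕ.suc k) with k ℕ.<? C
    ... | yes _ = 0≤z _
    ... | no  _ = 0≤1

    Z-last : Z F C z (ℕ.suc C) ≡ 1#
    Z-last with C ℕ.<? C
    ... | yes C<C = contradiction C<C (ℕ.n≮n C)
    ... | no  _   = refl

    xTerm yTerm : ℕ → Carrier
    xTerm k = a F C k * Z F C z (ℕ.suc k)
    yTerm k = a F C k * Z F C z k

    xTerm-nonneg : ∀ k → 0# ≤ xTerm k
    xTerm-nonneg k = 0≤* (fromℕ-nonneg (aℕ F C k)) (Z-nonneg (ℕ.suc k))

    yTerm-nonneg : ∀ k → 0# ≤ yTerm k
    yTerm-nonneg k = 0≤* (fromℕ-nonneg (aℕ F C k)) (Z-nonneg k)

    x≡sum : x ≡ sumFrom 1 C xTerm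
    x≡sum = Σ≡sumFrom xTerm C C 1 (ℕ.+-comm C 1)

    y≡sum : y ≡ sumFrom 2 n yTerm
    y≡sum = Σ≡sumFrom yTerm C n 2 (ℕ.+-comm n 2)

    -- x ≥ a_C z_{C+1} = a_C ≥ 1.
    1≤x : 1# ≤ x
    1≤x = subst (1# ≤_) (sym x≡sum) (≤-trans 1≤xTerm-C (sumFrom-last xTerm-nonneg 1 n))
      where
      1≤xTerm-C : 1# ≤ xTerm C
      1≤xTerm-C = subst (1# ≤_) (sym (trans (cong (a F C C *_) Z-last) (*-identityʳ (a F C C))))
                    (subst (1# ≤_) (sym (a≡P′ {C} ℕ.≤-refl)) (1≤fromℕ (P′-positive {C} ℕ.≤-refl)))

    0≤y : 0# ≤ y
    0≤y = subst (0# ≤_) (sym y≡sum) (sumFrom-nonneg yTerm-nonneg 2 n)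

    -- y ≤ (C - 1) x, comparing a_{k+1} z_{k+1} with (C - 1) a_k z_{k+1} termwise.
    y≤mx : y ≤ fromℕ F (C ℕ.∸ 1) * x
    y≤mx = begin
      y                                          ≡⟨ y≡sum ⟩
      sumFrom 2 n yTerm                          ≡⟨ sumFrom-shift yTerm 1 n ⟩
      sumFrom 1 n (λ j → yTerm (ℕ.suc j))        ≤⟨ sumFrom-mono 1 n termwise ⟩
      sumFrom 1 n (λ j → m * xTerm j)            ≤⟨ sumFrom-init (λ j → 0≤* (fromℕ-nonneg n) (xTerm-nonneg j)) 1 n ⟩
      sumFrom 1 C (λ j → m * xTerm j)            ≡⟨ sym (sumFrom-scale m xTerm 1 C) ⟩
      m * sumFrom 1 C xTerm                      ≡⟨ cong (m *_) (sym x≡sum) ⟩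
      m * x                                      ∎
      where
      open ≤-Reasoning
      m : Carrier
      m = fromℕ F (C ℕ.∸ 1)
      termwise : ∀ j → 1 ≤ℕ j → j ℕ.< 1 ℕ.+ n → yTerm (ℕ.suc j) ≤ m * xTerm j
      termwise j 1≤j j<C = subst (yTerm (ℕ.suc j) ≤_) (*-assoc m _ _)
                             (*-monoʳ-≤ (Z-nonneg (ℕ.suc j)) (a-step 1≤j j<C))

lemma4 : ∀ {c ℓ} (F : OrderedField c ℓ) → let open OrderedField F in
         (C : ℕ) → 4 ≤ℕ C → (z : Fin C → Carrier) → (∀ j → 0# ≤ z j) →
         Quantities.y F C z ≤ a F C 1 * Z F C z 1 →
         fromℕ F 6 * (fromℕ F 7) ⁻¹ ≤ Quantities.R̃ F C z
lemma4 F ℕ.zero    ()  z 0≤z y≤a₁z₁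
lemma4 F (ℕ.suc n) 4≤C z 0≤z y≤a₁z₁ =
  Bound.ratio-bound (coefficients 4≤C) (Z-nonneg 1) 0≤y 1≤x y≤a₁z₁ y≤mx
  where
  open OrderedFieldTheory F
  open PaperQuantities F
  open Sums n z 0≤z
  open Ratio (a F C) (Z F C z 1) (Quantities.x F C z) (Quantities.y F C z)
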